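{- Let $G$ be a connected graph with at least two vertices, and let $k$ be a positive integer. Then $\dim_{k,f}(G)=1$ if and only if $G$ is isomorphic to the path $P_i$ for some $i\in\{2,3,\ldots,k+2\}$.
   Context: All graphs are finite, simple, undirected and connected; $P_i$ is the path on $i$ vertices. $d(x,y)$ denotes the distance in $G$. For a positive integer $k$, $d_k(x,y)=\min\{d(x,y),k+1\}$, and for distinct $x,y\in V(G)$, $R_k\{x,y\}=\{z\in V(G): d_k(x,z)\neq d_k(y,z)\}$. For $g$ defined on $V(G)$ and $U\subseteq V(G)$, $g(U)=\sum_{s\in U}g(s)$. A function $h:V(G)\to[0,1]$ is a $k$-truncated resolving function of $G$ if $h(R_k\{x,y\})\ge 1$ for all distinct $x,y\in V(G)$; $\dim_{k,f}(G)=\min\{h(V(G)): h \text{ is a } k\text{ -truncated resolving function of } G\}$.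
   Formalization: The k-truncated resolving functions h, including those over which $\dim_{k,f}(G)$ is minimised, take rational values in [0,1] rather than real ones. -}

module Defs where

open import Data.Nat as ℕ using (ℕ; zero; suc; _∸_)
open import Data.Bool using (Bool; true; false; _∨_; _∧_; if_then_else_)
open import Data.Fin using (Fin; toℕ)
open import Data.Fin.Properties using (any?)
open import Data.Rational as ℚ using (ℚ; 0ℚ; 1ℚ)
open import Data.Product using (Σ; ∃; _×_; _,_)
open import Relation.Binary.PropositionalEquality using (_≡_; _≢_)
open import Relation.Nullary using (Dec; yes; no; does; ¬_)
open import Function.Bundles using (_⤖_; Bijection)

record Graph : Set where
  field
    n       : ℕ
    adj     : Fin n → Fin n → Bool
    symm    : ∀ x y → adj x y ≡ adj y x
    irrefl  : ∀ x → adj x x ≡ false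

open Graph public

anyFin : {m : ℕ} → (Fin m → Bool) → Bool
anyFin {zero}  p = false
anyFin {suc m} p = p Data.Fin.zero ∨ anyFin {m} (λ z → p (Data.Fin.suc z))

reach : (G : Graph) → ℕ → Fin (n G) → Fin (n G) → Bool
reach G zero    x y = does (x Data.Fin.≟ y)
reach G (suc m) x y = reach G m x y ∨ anyFin (λ z → reach G m x z ∧ adj G z y)

Connected : Graph → Set
Connected G = ∀ x y → ∃ λ m → reach G m x y ≡ true

search : (G : Graph) → Fin (n G) → Fin (n G) → ℕ → ℕ → ℕ
search G x y i zero       = i
search G x y i (suc fuel) = if reach G i x y then i else search G x y (suc i) fuel

-- graph distance d(x,y): least m with a walk of length m from x to y
-- (for a connected graph this is ≤ n - 1, so searching m ∈ {0,…,n} suffices)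
dist : (G : Graph) → Fin (n G) → Fin (n G) → ℕ
dist G x y = search G x y 0 (n G)

distk : (G : Graph) → ℕ → Fin (n G) → Fin (n G) → ℕ
distk G k x y = dist G x y ℕ.⊓ suc k

sumFin : {m : ℕ} → (Fin m → ℚ) → ℚ
sumFin {zero}  g = 0ℚ
sumFin {suc m} g = g Data.Fin.zero ℚ.+ sumFin {m} (λ z → g (Data.Fin.suc z))

-- h(R_k{x,y}) = Σ_{z : d_k(x,z) ≠ d_k(y,z)} h(z)
weightRk : (G : Graph) → ℕ → (Fin (n G) → ℚ) → Fin (n G) → Fin (n G) → ℚ
weightRk G k h x y =
  sumFin (λ z → if does (distk G k x z ℕ.≟ distk G k y z) then 0ℚ else h z)

IsTruncResolving : (G : Graph) → ℕ → (Fin (n G) → ℚ) → Set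
IsTruncResolving G k h =
  (∀ v → (0ℚ ℚ.≤ h v) × (h v ℚ.≤ 1ℚ)) ×
  (∀ x y → x ≢ y → 1ℚ ℚ.≤ weightRk G k h x y)

DimKF≡ : (G : Graph) → ℕ → ℚ → Set
DimKF≡ G k q =
  (Σ (Fin (n G) → ℚ) λ h → IsTruncResolving G k h × sumFin h ≡ q) ×
  (∀ h → IsTruncResolving G k h → q ℚ.≤ sumFin h)

-- the path P_i on vertex set Fin i: a ~ b iff |a - b| = 1
pathAdj : {i : ℕ} → Fin i → Fin i → Bool
pathAdj a b = does ((toℕ a ∸ toℕ b) ℕ.+ (toℕ b ∸ toℕ a) ℕ.≟ 1)

IsoToPath : Graph → ℕ → Set
IsoToPath G i =
  Σ (Fin (n G) ⤖ Fin i) λ σ →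
    ∀ x y → adj G x y ≡ pathAdj (Bijection.to σ x) (Bijection.to σ y)

{-# OPTIONS --safe #-}
-- For distinct vertices x, y every k-truncated resolving function h satisfies
-- 1 ≤ h(R_k{x,y}) ≤ h(V), so dim_{k,f}(G) ≥ 1 always. If h(V) = 1, a vertex s with
-- h(s) > 0 must lie in every R_k{x,y}, i.e. x ↦ d_k(x,s) is injective. The distance
-- layers from s are nonempty up to the eccentricity of s, so this injectivity forces
-- all distances to be at most k+1 and every layer to be a single vertex; consecutive
-- singleton layers are joined by an edge and nothing else is, so G is a path with
-- endpoint s on at most k+2 vertices. Conversely, in P_i with i ≤ k+2 the truncated
-- distances from an endpoint are the positions 0,…,i−1, so the indicator function
-- of that endpoint is resolving of weight 1.
module Submission where

open import Defs
open import Data.Nat using (ℕ; _≤_; suc)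
open import Data.Rational using (1ℚ)
open import Data.Product using (∃; _×_)
open import Function.Bundles using (_⇔_)

open import Data.Nat as ℕ using (zero; _<_; _≤′_; z≤n; s≤s; _⊓_; _∸_)
import Data.Nat.Properties as ℕP
open import Data.Bool as Bool using (Bool; true; false; _∨_; _∧_; if_then_else_)
open import Data.Bool.Properties using (∨-zeroʳ; ¬-not)
open import Data.Fin as Fin using (Fin; toℕ; fromℕ<)
import Data.Fin.Properties as FinP
open import Data.Rational as ℚ using (ℚ; 0ℚ)
import Data.Rational.Properties as ℚP
open import Data.Product using (_,_; proj₁; proj₂)
open import Data.Sum as Sum using (_⊎_; inj₁; inj₂)
open import Data.Unit using (tt)
open import Data.Empty using (⊥-elim)
open import Relation.Nullary using (yes; no; does; Dec; contradiction)
open import Relation.Nullary.Decidable using (dec-true; dec-false; toWitness)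
open import Relation.Binary using (tri<; tri≈; tri>)
open import Relation.Binary.PropositionalEquality
open import Function.Base using (_∘_)
open import Function.Bundles using (_⤖_; Bijection; Equivalence; mk⤖; mk⇔)
open import Function.Definitions using (Injective; Surjective)
open import Function.Consequences.Propositional using (strictlySurjective⇒surjective)

∨-true⁻ : ∀ a {b} → a ∨ b ≡ true → a ≡ true ⊎ b ≡ true
∨-true⁻ true  _ = inj₁ refl
∨-true⁻ false e = inj₂ e

∧-true⁻ : ∀ a {b} → a ∧ b ≡ true → a ≡ true × b ≡ true
∧-true⁻ true e = refl , e

does-true⁻ : ∀ {P : Set} (P? : Dec P) → does P? ≡ true → P
does-true⁻ (yes p) _ = p

≡-does : ∀ {P : Set} {b : Bool} (P? : Dec P) → (b ≡ true → P) → (P → b ≡ true) → b ≡ does P?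
≡-does (yes p) _   from = from p
≡-does (no ¬p) to  _    = ¬-not (¬p ∘ to)

anyFin⁺ : ∀ {m} (p : Fin m → Bool) z → p z ≡ true → anyFin p ≡ true
anyFin⁺ p Fin.zero    e rewrite e = refl
anyFin⁺ p (Fin.suc z) e = trans (cong (p Fin.zero ∨_) (anyFin⁺ (p ∘ Fin.suc) z e)) (∨-zeroʳ _)

anyFin⁻ : ∀ {m} (p : Fin m → Bool) → anyFin p ≡ true → ∃ λ z → p z ≡ true
anyFin⁻ {suc m} p e with ∨-true⁻ (p Fin.zero) e
... | inj₁ p₀ = Fin.zero , p₀
... | inj₂ ps with anyFin⁻ (p ∘ Fin.suc) ps
...   | z , pz = Fin.suc z , pz

module _ (G : Graph) where
  private
    V : Set
    V = Fin (n G)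

  adj-sym : ∀ {x y : V} → adj G x y ≡ true → adj G y x ≡ true
  adj-sym {x} {y} a = trans (symm G y x) a

  reach-refl : ∀ (x : V) → reach G 0 x x ≡ true
  reach-refl x = dec-true (x Fin.≟ x) refl

  reach-zero⁻ : ∀ (x y : V) → reach G 0 x y ≡ true → x ≡ y
  reach-zero⁻ x y = does-true⁻ (x Fin.≟ y)

  reach-suc : ∀ m (x y : V) → reach G m x y ≡ true → reach G (suc m) x y ≡ true
  reach-suc m x y r rewrite r = refl

  reach-mono : ∀ {m m′} (x y : V) → m ≤ m′ → reach G m x y ≡ true → reach G m′ x y ≡ true
  reach-mono x y = go ∘ ℕP.≤⇒≤′
    where
    go : ∀ {m m′} → m ≤′ m′ → reach G m x y ≡ true → reach G m′ x y ≡ true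
    go ℕ.≤′-refl                   r = r
    go (ℕ.≤′-step {n = m′} m≤′m′) r = reach-suc m′ x y (go m≤′m′ r)

  reach-step : ∀ m (x z y : V) → reach G m x z ≡ true → adj G z y ≡ true → reach G (suc m) x y ≡ true
  reach-step m x z y r a =
    trans (cong (reach G m x y ∨_) (anyFin⁺ (λ w → reach G m x w ∧ adj G w y) z xzy)) (∨-zeroʳ _)
    where
    xzy : reach G m x z ∧ adj G z y ≡ true
    xzy rewrite r | a = refl

  reach-suc⁻ : ∀ m (x y : V) → reach G (suc m) x y ≡ true →
    reach G m x y ≡ true ⊎ ∃ λ z → reach G m x z ≡ true × adj G z y ≡ true
  reach-suc⁻ m x y r with ∨-true⁻ (reach G m x y) r
  ... | inj₁ r′ = inj₁ r′
  ... | inj₂ e with anyFin⁻ (λ w → reach G m x w ∧ adj G w y) e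
  ...   | z , xzy = inj₂ (z , ∧-true⁻ (reach G m x z) xzy)

  reach-prepend : ∀ m (y z x : V) → adj G y z ≡ true → reach G m z x ≡ true →
    reach G (suc m) y x ≡ true
  reach-prepend zero y z x a r with reach-zero⁻ z x r
  ... | refl = reach-step 0 y y z (reach-refl y) a
  reach-prepend (suc m) y z x a r with reach-suc⁻ m z x r
  ... | inj₁ r′           = reach-suc (suc m) y x (reach-prepend m y z x a r′)
  ... | inj₂ (w , r′ , a′) = reach-step (suc m) y w x (reach-prepend m y z w a r′) a′

  reach-sym : ∀ m (x y : V) → reach G m x y ≡ true → reach G m y x ≡ true
  reach-sym zero x y r with reach-zero⁻ x y r
  ... | refl = r
  reach-sym (suc m) x y r with reach-suc⁻ m x y r
  ... | inj₁ r′           = reach-suc m y x (reach-sym m x y r′)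
  ... | inj₂ (z , r′ , a) = reach-prepend m y z x (adj-sym a) (reach-sym m x z r′)

  IsDistance : V → V → ℕ → Set
  IsDistance x y d = reach G d x y ≡ true × (∀ j → j < d → reach G j x y ≡ false)

  isDistance-below : ∀ {x y d j} → IsDistance x y d → j < d → reach G j x y ≢ true
  isDistance-below (_ , below) j<d r = contradiction (trans (sym (below _ j<d)) r) λ ()

  isDistance-minimal : ∀ {x y d} j → IsDistance x y d → reach G j x y ≡ true → d ≤ j
  isDistance-minimal j xy r = ℕP.≮⇒≥ (λ j<d → isDistance-below xy j<d r)

  isDistance-unique : ∀ {x y d d′} → IsDistance x y d → IsDistance x y d′ → d ≡ d′
  isDistance-unique {d = d} {d′} p q =
    ℕP.≤-antisym (isDistance-minimal d′ p (proj₁ q)) (isDistance-minimal d q (proj₁ p))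

  isDistance-exists : ∀ m (x y : V) → reach G m x y ≡ true → ∃ (IsDistance x y)
  isDistance-exists zero    x y r = 0 , r , λ _ ()
  isDistance-exists (suc m) x y r with reach G m x y Bool.≟ true
  ... | yes r′ = isDistance-exists m x y r′
  ... | no ¬r′ = suc m , r , λ j j<1+m → ¬-not λ rj → ¬r′ (reach-mono x y (ℕP.≤-pred j<1+m) rj)

  isDistance-sym : ∀ {x y d} → IsDistance x y d → IsDistance y x d
  isDistance-sym {x} {y} {d} xy@(r , _) =
    reach-sym d x y r , λ j j<d → ¬-not λ rj → isDistance-below xy j<d (reach-sym j y x rj)

  isDistance-adj : ∀ {s z x d e} → IsDistance s z d → IsDistance s x e → adj G z x ≡ true → e ≤ suc d
  isDistance-adj {s} {z} {x} {d} sz sx a = isDistance-minimal (suc d) sx (reach-step d s z x (proj₁ sz) a)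

  isDistance-pred : ∀ {s x m} → IsDistance s x (suc m) →
    ∃ λ z → adj G z x ≡ true × IsDistance s z m
  isDistance-pred {s} {x} {m} sx@(r , _) with reach-suc⁻ m s x r
  ... | inj₁ r′           = contradiction r′ (isDistance-below sx (ℕP.n<1+n m))
  ... | inj₂ (z , r′ , a) =
    z , a , r′ , λ j j<m → ¬-not λ rj → isDistance-below sx (s≤s j<m) (reach-step j s z x rj a)

  search-isDistance : ∀ {x y d} i fuel → IsDistance x y d → i ≤ d →
    search G x y i fuel ≡ d ⊓ (i ℕ.+ fuel)
  search-isDistance {d = d} i zero xy i≤d rewrite ℕP.+-identityʳ i = sym (ℕP.m≥n⇒m⊓n≡n i≤d)
  search-isDistance {x} {y} {d} i (suc fuel) xy i≤d with reach G i x y in e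
  ... | true with refl ← ℕP.≤-antisym i≤d (isDistance-minimal i xy e) =
    sym (ℕP.m≤n⇒m⊓n≡m (ℕP.m≤m+n i (suc fuel)))
  ... | false = begin
    search G x y (suc i) fuel ≡⟨ search-isDistance (suc i) fuel xy (ℕP.≤∧≢⇒< i≤d i≢d) ⟩
    d ⊓ (suc i ℕ.+ fuel)      ≡⟨ cong (d ⊓_) (sym (ℕP.+-suc i fuel)) ⟩
    d ⊓ (i ℕ.+ suc fuel)      ∎
    where
    open ≡-Reasoning
    i≢d : i ≢ d
    i≢d refl = contradiction (trans (sym e) (proj₁ xy)) λ ()

  dist-isDistance : ∀ {x y d} → IsDistance x y d → dist G x y ≡ d ⊓ n G
  dist-isDistance xy = search-isDistance 0 (n G) xy z≤n

  record IsLayering (s : V) (ℓ : V → ℕ) : Set where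
    field
      at-root     : ℓ s ≡ 0
      root-only   : ∀ x → ℓ x ≡ 0 → s ≡ x
      adj-≤       : ∀ z x → adj G z x ≡ true → ℓ x ≤ suc (ℓ z)
      predecessor : ∀ x m → ℓ x ≡ suc m → ∃ λ z → adj G z x ≡ true × ℓ z ≡ m

  layering⇒isDistance : ∀ {s ℓ} → IsLayering s ℓ → ∀ x → IsDistance s x (ℓ x)
  layering⇒isDistance {s} {ℓ} L x =
    within (ℓ x) x ℕP.≤-refl , λ j j<ℓx → ¬-not λ r → ℕP.<⇒≱ j<ℓx (bounded j x r)
    where
    open IsLayering L
    bounded : ∀ m x → reach G m s x ≡ true → ℓ x ≤ m
    bounded zero    x r = ℕP.≤-reflexive (trans (cong ℓ (sym (reach-zero⁻ s x r))) at-root)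
    bounded (suc m) x r with reach-suc⁻ m s x r
    ... | inj₁ r′           = ℕP.m≤n⇒m≤1+n (bounded m x r′)
    ... | inj₂ (z , r′ , a) = ℕP.≤-trans (adj-≤ z x a) (s≤s (bounded m z r′))
    within : ∀ m x → ℓ x ≤ m → reach G m s x ≡ true
    within zero x ℓx≤0 =
      subst (λ t → reach G 0 s t ≡ true) (root-only x (ℕP.n≤0⇒n≡0 ℓx≤0)) (reach-refl s)
    within (suc m) x ℓx≤1+m with ℕP.m≤n⇒m<n∨m≡n ℓx≤1+m
    ... | inj₁ (s≤s ℓx≤m) = reach-suc m s x (within m x ℓx≤m)
    ... | inj₂ ℓx≡1+m with predecessor x m ℓx≡1+m
    ...   | z , a , ℓz≡m = reach-step m s z x (within m z (ℕP.≤-reflexive ℓz≡m)) a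

  connected⇒layering : Connected G → ∀ s → ∃ (IsLayering s)
  connected⇒layering conn s = ℓ , record
    { at-root     = isDistance-unique (ℓ-isDistance s) (reach-refl s , λ _ ())
    ; root-only   = λ x ℓx≡0 →
        reach-zero⁻ s x (subst (λ d → reach G d s x ≡ true) ℓx≡0 (proj₁ (ℓ-isDistance x)))
    ; adj-≤       = λ z x → isDistance-adj (ℓ-isDistance z) (ℓ-isDistance x)
    ; predecessor = λ x m ℓx≡1+m →
        let z , a , sz = isDistance-pred (subst (IsDistance s x) ℓx≡1+m (ℓ-isDistance x))
        in  z , a , isDistance-unique (ℓ-isDistance z) sz
    }
    where
    distanceFrom : ∀ x → ∃ (IsDistance s x)
    distanceFrom x = isDistance-exists (proj₁ (conn s x)) s x (proj₂ (conn s x))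
    ℓ : V → ℕ
    ℓ = proj₁ ∘ distanceFrom
    ℓ-isDistance : ∀ x → IsDistance s x (ℓ x)
    ℓ-isDistance = proj₂ ∘ distanceFrom

sumFin-zero : ∀ {m} → sumFin {m} (λ _ → 0ℚ) ≡ 0ℚ
sumFin-zero {zero}  = refl
sumFin-zero {suc m} = trans (ℚP.+-identityˡ _) (sumFin-zero {m})

sumFin-mono : ∀ {m} (g h : Fin m → ℚ) → (∀ z → g z ℚ.≤ h z) → sumFin g ℚ.≤ sumFin h
sumFin-mono {zero}  g h g≤h = ℚP.≤-refl
sumFin-mono {suc m} g h g≤h =
  ℚP.+-mono-≤ (g≤h Fin.zero) (sumFin-mono (g ∘ Fin.suc) (h ∘ Fin.suc) (g≤h ∘ Fin.suc))

sumFin-nonneg : ∀ {m} (g : Fin m → ℚ) → (∀ z → 0ℚ ℚ.≤ g z) → 0ℚ ℚ.≤ sumFin g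
sumFin-nonneg {m} g g≥0 = subst (ℚ._≤ sumFin g) (sumFin-zero {m}) (sumFin-mono (λ _ → 0ℚ) g g≥0)

sumFin-positive⇒∃-positive : ∀ {m} (g : Fin m → ℚ) → 0ℚ ℚ.< sumFin g → ∃ λ z → 0ℚ ℚ.< g z
sumFin-positive⇒∃-positive {m} g 0<Σg with FinP.any? (λ z → 0ℚ ℚP.<? g z)
... | yes positive = positive
... | no ¬positive = ⊥-elim (ℚP.<-irrefl refl (ℚP.<-≤-trans 0<Σg Σg≤0))
  where
  Σg≤0 : sumFin g ℚ.≤ 0ℚ
  Σg≤0 = subst (sumFin g ℚ.≤_) (sumFin-zero {m})
           (sumFin-mono g (λ _ → 0ℚ) (λ z → ℚP.≮⇒≥ (¬positive ∘ (z ,_))))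

term-≤-sumFin : ∀ {m} (g : Fin m → ℚ) → (∀ z → 0ℚ ℚ.≤ g z) → ∀ s → g s ℚ.≤ sumFin g
term-≤-sumFin g g≥0 Fin.zero =
  subst (ℚ._≤ sumFin g) (ℚP.+-identityʳ (g Fin.zero))
    (ℚP.+-monoʳ-≤ (g Fin.zero) (sumFin-nonneg (g ∘ Fin.suc) (g≥0 ∘ Fin.suc)))
term-≤-sumFin g g≥0 (Fin.suc s) =
  ℚP.≤-trans (term-≤-sumFin (g ∘ Fin.suc) (g≥0 ∘ Fin.suc) s)
    (subst (ℚ._≤ sumFin g) (ℚP.+-identityˡ _) (ℚP.+-monoˡ-≤ (sumFin (g ∘ Fin.suc)) (g≥0 Fin.zero)))

sumFin-+-dropped-≤ : ∀ {m} (g h : Fin m → ℚ) s → (∀ z → g z ℚ.≤ h z) → g s ≡ 0ℚ →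
  sumFin g ℚ.+ h s ℚ.≤ sumFin h
sumFin-+-dropped-≤ g h Fin.zero g≤h gs≡0
  rewrite gs≡0 | ℚP.+-identityˡ (sumFin (g ∘ Fin.suc)) | ℚP.+-comm (sumFin (g ∘ Fin.suc)) (h Fin.zero)
  = ℚP.+-monoʳ-≤ (h Fin.zero) (sumFin-mono (g ∘ Fin.suc) (h ∘ Fin.suc) (g≤h ∘ Fin.suc))
sumFin-+-dropped-≤ g h (Fin.suc s) g≤h gs≡0
  rewrite ℚP.+-assoc (g Fin.zero) (sumFin (g ∘ Fin.suc)) (h (Fin.suc s))
  = ℚP.+-mono-≤ (g≤h Fin.zero) (sumFin-+-dropped-≤ (g ∘ Fin.suc) (h ∘ Fin.suc) s (g≤h ∘ Fin.suc) gs≡0)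

indicator : ∀ {m} → Fin m → Fin m → ℚ
indicator s z = if does (z Fin.≟ s) then 1ℚ else 0ℚ

sumFin-indicator : ∀ {m} (s : Fin m) → sumFin (indicator s) ≡ 1ℚ
sumFin-indicator {suc m} Fin.zero    = trans (cong (1ℚ ℚ.+_) (sumFin-zero {m})) (ℚP.+-identityʳ 1ℚ)
sumFin-indicator {suc m} (Fin.suc s) = trans (ℚP.+-identityˡ _) (sumFin-indicator s)

injective⇒surjective : ∀ {m} {f : Fin m → Fin m} → Injective _≡_ _≡_ f → ∀ i → ∃ λ x → f x ≡ i
injective⇒surjective {suc m} {f} f-inj i with FinP.any? (λ x → f x Fin.≟ i)
... | yes hit = hit
... | no miss = contradiction (FinP.injective⇒≤ punchOut∘f-injective) ℕP.1+n≰n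
  where
  i≢f : ∀ x → i ≢ f x
  i≢f x i≡fx = miss (x , sym i≡fx)
  punchOut∘f-injective : Injective _≡_ _≡_ (λ x → Fin.punchOut (i≢f x))
  punchOut∘f-injective {x} {y} = f-inj ∘ FinP.punchOut-injective (i≢f x) (i≢f y)

DownClosed : ∀ {A : Set} → (A → ℕ) → Set
DownClosed f = ∀ x m → m ≤ f x → ∃ λ w → f w ≡ m

downClosed-⊓-injective⇒≤ : ∀ {A : Set} {f : A → ℕ} c → DownClosed f →
  (∀ x y → f x ⊓ c ≡ f y ⊓ c → x ≡ y) → ∀ x → f x ≤ c
downClosed-⊓-injective⇒≤ {f = f} c down ⊓c-inj x with c ℕP.<? f x
... | no c≮fx = ℕP.≮⇒≥ c≮fx
... | yes c<fx with down x c (ℕP.<⇒≤ c<fx)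
...   | w , fw≡c = contradiction (trans (sym fw≡c) (cong f (⊓c-inj w x wx))) (ℕP.<⇒≢ c<fx)
  where
  wx : f w ⊓ c ≡ f x ⊓ c
  wx = trans (cong (_⊓ c) fw≡c) (trans (ℕP.⊓-idem c) (sym (ℕP.m≥n⇒m⊓n≡n (ℕP.<⇒≤ c<fx))))

downClosed-injective⇒< : ∀ {m} {f : Fin m → ℕ} → DownClosed f → Injective _≡_ _≡_ f → ∀ x → f x < m
downClosed-injective⇒< {m} {f} down f-inj x with m ℕP.≤? f x
... | no m≰fx = ℕP.≰⇒> m≰fx
... | yes m≤fx = contradiction (FinP.injective⇒≤ g-injective) ℕP.1+n≰n
  where
  below : ∀ (j : Fin (suc m)) → ∃ λ w → f w ≡ toℕ j
  below j = down x (toℕ j) (ℕP.≤-trans (ℕP.≤-pred (FinP.toℕ<n j)) m≤fx)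
  g-injective : Injective _≡_ _≡_ (proj₁ ∘ below)
  g-injective {i} {j} gi≡gj =
    FinP.toℕ-injective (trans (sym (proj₂ (below i))) (trans (cong f gi≡gj) (proj₂ (below j))))

UnitApart : ℕ → ℕ → Set
UnitApart a b = (a ∸ b) ℕ.+ (b ∸ a) ≡ 1

unitApart? : ∀ a b → Dec (UnitApart a b)
unitApart? a b = (a ∸ b) ℕ.+ (b ∸ a) ℕ.≟ 1

unitApart-suc : ∀ a → UnitApart a (suc a)
unitApart-suc zero    = refl
unitApart-suc (suc a) = unitApart-suc a

unitApart-sym : ∀ {a b} → UnitApart a b → UnitApart b a
unitApart-sym {a} {b} = trans (ℕP.+-comm (b ∸ a) (a ∸ b))

unitApart⇔ : ∀ a b → UnitApart a b ⇔ (b ≡ suc a ⊎ a ≡ suc b)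
unitApart⇔ a b = mk⇔ (to a b) from
  where
  to : ∀ a b → UnitApart a b → b ≡ suc a ⊎ a ≡ suc b
  to zero    (suc b) e = inj₁ e
  to (suc a) zero    e = inj₂ (trans (sym (ℕP.+-identityʳ (suc a))) e)
  to (suc a) (suc b) e = Sum.map (cong suc) (cong suc) (to a b e)
  from : b ≡ suc a ⊎ a ≡ suc b → UnitApart a b
  from (inj₁ refl) = unitApart-suc a
  from (inj₂ refl) = unitApart-sym {b} (unitApart-suc b)

IsTruncResolvingVertex : (G : Graph) → ℕ → Fin (n G) → Set
IsTruncResolvingVertex G k s = ∀ x y → distk G k x s ≡ distk G k y s → x ≡ y

module _ (G : Graph) (k : ℕ) (h : Fin (n G) → ℚ) (h≥0 : ∀ v → 0ℚ ℚ.≤ h v) (x y : Fin (n G)) where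
  private
    summand : Fin (n G) → ℚ
    summand z = if does (distk G k x z ℕ.≟ distk G k y z) then 0ℚ else h z

    summand-≤ : ∀ z → summand z ℚ.≤ h z
    summand-≤ z with does (distk G k x z ℕ.≟ distk G k y z)
    ... | true  = h≥0 z
    ... | false = ℚP.≤-refl

    summand-≥0 : ∀ z → 0ℚ ℚ.≤ summand z
    summand-≥0 z with does (distk G k x z ℕ.≟ distk G k y z)
    ... | true  = ℚP.≤-refl
    ... | false = h≥0 z

  weightRk-≤-sumFin : weightRk G k h x y ℚ.≤ sumFin h
  weightRk-≤-sumFin = sumFin-mono summand h summand-≤

  weightRk-≥-separator : ∀ s → distk G k x s ≢ distk G k y s → h s ℚ.≤ weightRk G k h x y
  weightRk-≥-separator s separates =
    subst (ℚ._≤ weightRk G k h x y) summand-s (term-≤-sumFin summand summand-≥0 s)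
    where
    summand-s : summand s ≡ h s
    summand-s rewrite dec-false (distk G k x s ℕ.≟ distk G k y s) separates = refl

  weightRk-+-nonseparator-≤ : ∀ s → distk G k x s ≡ distk G k y s →
    weightRk G k h x y ℚ.+ h s ℚ.≤ sumFin h
  weightRk-+-nonseparator-≤ s same = sumFin-+-dropped-≤ summand h s summand-≤ summand-s
    where
    summand-s : summand s ≡ 0ℚ
    summand-s rewrite dec-true (distk G k x s ℕ.≟ distk G k y s) same = refl

resolving⇒1≤sumFin : ∀ G k h → 2 ≤ n G → IsTruncResolving G k h → 1ℚ ℚ.≤ sumFin h
resolving⇒1≤sumFin G k h 2≤n (bounds , resolves) =
  ℚP.≤-trans (resolves x₀ x₁ x₀≢x₁) (weightRk-≤-sumFin G k h (proj₁ ∘ bounds) x₀ x₁)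
  where
  0<n : 0 < n G
  0<n = ℕP.≤-trans (s≤s z≤n) 2≤n
  x₀ x₁ : Fin (n G)
  x₀ = fromℕ< 0<n
  x₁ = fromℕ< 2≤n
  x₀≢x₁ : x₀ ≢ x₁
  x₀≢x₁ x₀≡x₁ with () ← FinP.fromℕ<-injective 0 1 0<n 2≤n x₀≡x₁

unitResolving⇒resolvingVertex : ∀ G k h s → IsTruncResolving G k h → sumFin h ≡ 1ℚ → 0ℚ ℚ.< h s →
  IsTruncResolvingVertex G k s
unitResolving⇒resolvingVertex G k h s (bounds , resolves) Σh≡1 0<hs x y same with x Fin.≟ y
... | yes x≡y = x≡y
... | no  x≢y = ⊥-elim (ℚP.<-irrefl refl (ℚP.<-≤-trans 1<1+hs 1+hs≤1))
  where
  1<1+hs : 1ℚ ℚ.< 1ℚ ℚ.+ h s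
  1<1+hs = subst (ℚ._< 1ℚ ℚ.+ h s) (ℚP.+-identityʳ 1ℚ) (ℚP.+-monoʳ-< 1ℚ 0<hs)
  1+hs≤1 : 1ℚ ℚ.+ h s ℚ.≤ 1ℚ
  1+hs≤1 = ℚP.≤-trans (ℚP.+-monoˡ-≤ (h s) (resolves x y x≢y))
             (subst (weightRk G k h x y ℚ.+ h s ℚ.≤_) Σh≡1
               (weightRk-+-nonseparator-≤ G k h (proj₁ ∘ bounds) x y s same))

indicator-resolving : ∀ G k s → IsTruncResolvingVertex G k s → IsTruncResolving G k (indicator s)
indicator-resolving G k s resolving = bounds , resolves
  where
  0≤1 : 0ℚ ℚ.≤ 1ℚ
  0≤1 = toWitness {a? = 0ℚ ℚP.≤? 1ℚ} tt
  bounds : ∀ v → (0ℚ ℚ.≤ indicator s v) × (indicator s v ℚ.≤ 1ℚ)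
  bounds v with does (v Fin.≟ s)
  ... | true  = 0≤1 , ℚP.≤-refl
  ... | false = ℚP.≤-refl , 0≤1
  resolves : ∀ x y → x ≢ y → 1ℚ ℚ.≤ weightRk G k (indicator s) x y
  resolves x y x≢y = subst (ℚ._≤ weightRk G k (indicator s) x y) indicator-s
    (weightRk-≥-separator G k (indicator s) (proj₁ ∘ bounds) x y s (x≢y ∘ resolving x y))
    where
    indicator-s : indicator s s ≡ 1ℚ
    indicator-s rewrite dec-true (s Fin.≟ s) refl = refl

module ResolvingLayering (G : Graph) (k : ℕ) {s : Fin (n G)} {ℓ : Fin (n G) → ℕ}
  (layering : IsLayering G s ℓ) (resolving : IsTruncResolvingVertex G k s) where
  open IsLayering layering

  distk-layer : ∀ x → distk G k x s ≡ ℓ x ⊓ (n G ⊓ suc k)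
  distk-layer x = begin
    dist G x s ⊓ suc k   ≡⟨ cong (_⊓ suc k) (dist-isDistance G s-x) ⟩
    ℓ x ⊓ n G ⊓ suc k    ≡⟨ ℕP.⊓-assoc (ℓ x) (n G) (suc k) ⟩
    ℓ x ⊓ (n G ⊓ suc k)  ∎
    where
    open ≡-Reasoning
    s-x : IsDistance G x s (ℓ x)
    s-x = isDistance-sym G (layering⇒isDistance G layering x)

  layer-downClosed : DownClosed ℓ
  layer-downClosed x m m≤ℓx = descend (ℓ x ∸ m) x (sym (ℕP.m∸n+n≡m m≤ℓx))
    where
    descend : ∀ d x → ℓ x ≡ d ℕ.+ m → ∃ λ w → ℓ w ≡ m
    descend zero    x ℓx≡m   = x , ℓx≡m
    descend (suc d) x ℓx≡1+d+m with predecessor x (d ℕ.+ m) ℓx≡1+d+m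
    ... | z , _ , ℓz≡d+m = descend d z ℓz≡d+m

  layer-≤ : ∀ x → ℓ x ≤ n G ⊓ suc k
  layer-≤ = downClosed-⊓-injective⇒≤ (n G ⊓ suc k) layer-downClosed
    λ x y ℓx≡ℓy → resolving x y (trans (distk-layer x) (trans ℓx≡ℓy (sym (distk-layer y))))

  distk≡layer : ∀ x → distk G k x s ≡ ℓ x
  distk≡layer x = trans (distk-layer x) (ℕP.m≤n⇒m⊓n≡m (layer-≤ x))

  layer-injective : Injective _≡_ _≡_ ℓ
  layer-injective {x} {y} ℓx≡ℓy =
    resolving x y (trans (distk≡layer x) (trans ℓx≡ℓy (sym (distk≡layer y))))

  layer≤1+k : ∀ x → ℓ x ≤ suc k
  layer≤1+k x = ℕP.≤-trans (layer-≤ x) (ℕP.m⊓n≤n (n G) (suc k))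

  adj≡unitApart : ∀ x y → adj G x y ≡ does (unitApart? (ℓ x) (ℓ y))
  adj≡unitApart x y = ≡-does (unitApart? (ℓ x) (ℓ y))
    (Equivalence.from (unitApart⇔ (ℓ x) (ℓ y)) ∘ adj⇒consecutive)
    (consecutive⇒adj ∘ Equivalence.to (unitApart⇔ (ℓ x) (ℓ y)))
    where
    next⇒adj : ∀ x y → ℓ y ≡ suc (ℓ x) → adj G x y ≡ true
    next⇒adj x y ℓy≡1+ℓx with predecessor y (ℓ x) ℓy≡1+ℓx
    ... | z , a , ℓz≡ℓx = subst (λ t → adj G t y ≡ true) (layer-injective ℓz≡ℓx) a
    consecutive⇒adj : ℓ y ≡ suc (ℓ x) ⊎ ℓ x ≡ suc (ℓ y) → adj G x y ≡ true
    consecutive⇒adj (inj₁ ℓy≡1+ℓx) = next⇒adj x y ℓy≡1+ℓx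
    consecutive⇒adj (inj₂ ℓx≡1+ℓy) = adj-sym G (next⇒adj y x ℓx≡1+ℓy)
    adj⇒consecutive : adj G x y ≡ true → ℓ y ≡ suc (ℓ x) ⊎ ℓ x ≡ suc (ℓ y)
    adj⇒consecutive a with ℕP.<-cmp (ℓ x) (ℓ y)
    ... | tri< ℓx<ℓy _ _ = inj₁ (ℕP.≤-antisym (adj-≤ x y a) ℓx<ℓy)
    ... | tri> _ _ ℓy<ℓx = inj₂ (ℕP.≤-antisym (adj-≤ y x (adj-sym G a)) ℓy<ℓx)
    ... | tri≈ _ ℓx≡ℓy _ with refl ← layer-injective ℓx≡ℓy =
      contradiction (trans (sym (irrefl G x)) a) λ ()

  isoToPath : IsoToPath G (n G)
  isoToPath = mk⤖ (position-injective , position-surjective)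
            , λ x y → trans (adj≡unitApart x y)
                (cong₂ (λ a b → does (unitApart? a b)) (sym (toℕ-position x)) (sym (toℕ-position y)))
    where
    position : Fin (n G) → Fin (n G)
    position x = fromℕ< (downClosed-injective⇒< layer-downClosed layer-injective x)
    toℕ-position : ∀ x → toℕ (position x) ≡ ℓ x
    toℕ-position x = FinP.toℕ-fromℕ< _
    position-injective : Injective _≡_ _≡_ position
    position-injective = layer-injective ∘ FinP.fromℕ<-injective _ _ _ _
    position-surjective : Surjective _≡_ _≡_ position
    position-surjective = strictlySurjective⇒surjective (injective⇒surjective position-injective)

  n≤2+k : n G ≤ suc (suc k)
  n≤2+k = FinP.injective⇒≤ {f = λ x → fromℕ< (s≤s (layer≤1+k x))}
            (layer-injective ∘ FinP.fromℕ<-injective _ _ _ _)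

module PathEndpoint (G : Graph) {i : ℕ} (σ : Fin (n G) ⤖ Fin i)
  (σ-adj : ∀ x y → adj G x y ≡ pathAdj (Bijection.to σ x) (Bijection.to σ y)) (0<i : 0 < i) where
  open Bijection σ using (to; injective; strictlySurjective)

  position : Fin (n G) → ℕ
  position = toℕ ∘ to

  position-injective : Injective _≡_ _≡_ position
  position-injective = injective ∘ FinP.toℕ-injective

  from : Fin i → Fin (n G)
  from = proj₁ ∘ strictlySurjective

  to∘from : ∀ j → to (from j) ≡ j
  to∘from = proj₂ ∘ strictlySurjective

  i≤n : i ≤ n G
  i≤n = FinP.injective⇒≤ {f = from} λ {j} {j′} e → trans (sym (to∘from j)) (trans (cong to e) (to∘from j′))

  vertexAt : ∀ {m} → m < i → ∃ λ x → position x ≡ m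
  vertexAt m<i = from (fromℕ< m<i) , trans (cong toℕ (to∘from _)) (FinP.toℕ-fromℕ< m<i)

  endpoint : Fin (n G)
  endpoint = proj₁ (vertexAt 0<i)

  adj⇔unitApart : ∀ x y → adj G x y ≡ true ⇔ UnitApart (position x) (position y)
  adj⇔unitApart x y = mk⇔
    (does-true⁻ (unitApart? (position x) (position y)) ∘ trans (sym (σ-adj x y)))
    (trans (σ-adj x y) ∘ dec-true (unitApart? (position x) (position y)))

  position-layering : IsLayering G endpoint position
  position-layering = record
    { at-root     = proj₂ (vertexAt 0<i)
    ; root-only   = λ x p≡0 → position-injective (trans (proj₂ (vertexAt 0<i)) (sym p≡0))
    ; adj-≤       = adj-≤
    ; predecessor = predecessor
    }
    where
    adj-≤ : ∀ z x → adj G z x ≡ true → position x ≤ suc (position z)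
    adj-≤ z x a with Equivalence.to (unitApart⇔ _ _) (Equivalence.to (adj⇔unitApart z x) a)
    ... | inj₁ px≡1+pz = ℕP.≤-reflexive px≡1+pz
    ... | inj₂ pz≡1+px = ℕP.m≤n⇒m≤1+n (ℕP.<⇒≤ (ℕP.≤-reflexive (sym pz≡1+px)))
    predecessor : ∀ x m → position x ≡ suc m → ∃ λ z → adj G z x ≡ true × position z ≡ m
    predecessor x m px≡1+m = z , Equivalence.from (adj⇔unitApart z x) z-x , pz≡m
      where
      m<i : m < i
      m<i = ℕP.<-trans (ℕP.n<1+n m) (subst (_< i) px≡1+m (FinP.toℕ<n (to x)))
      z : Fin (n G)
      z = proj₁ (vertexAt m<i)
      pz≡m : position z ≡ m
      pz≡m = proj₂ (vertexAt m<i)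
      z-x : UnitApart (position z) (position x)
      z-x = Equivalence.from (unitApart⇔ _ _) (inj₁ (trans px≡1+m (cong suc (sym pz≡m))))

  endpoint-resolving : ∀ k → i ≤ suc (suc k) → IsTruncResolvingVertex G k endpoint
  endpoint-resolving k i≤2+k x y e =
    position-injective (trans (sym (distk≡position x)) (trans e (distk≡position y)))
    where
    distk≡position : ∀ x → distk G k x endpoint ≡ position x
    distk≡position x = begin
      dist G x endpoint ⊓ suc k    ≡⟨ cong (_⊓ suc k) (dist-isDistance G endpoint-x) ⟩
      position x ⊓ n G ⊓ suc k     ≡⟨ cong (_⊓ suc k) (ℕP.m≤n⇒m⊓n≡m (ℕP.<⇒≤ (ℕP.<-≤-trans px<i i≤n))) ⟩
      position x ⊓ suc k           ≡⟨ ℕP.m≤n⇒m⊓n≡m (ℕP.m<1+n⇒m≤n (ℕP.<-≤-trans px<i i≤2+k)) ⟩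
      position x                   ∎
      where
      open ≡-Reasoning
      endpoint-x : IsDistance G x endpoint (position x)
      endpoint-x = isDistance-sym G (layering⇒isDistance G position-layering x)
      px<i : position x < i
      px<i = FinP.toℕ<n (to x)

theorem2p7 : (G : Graph) → Connected G → 2 ≤ n G → (k : ℕ) → 1 ≤ k →
    DimKF≡ G k 1ℚ ⇔ (∃ λ i → (2 ≤ i) × (i ≤ suc (suc k)) × IsoToPath G i)
theorem2p7 G conn 2≤n k _ = mk⇔ forward backward
  where
  forward : DimKF≡ G k 1ℚ → ∃ λ i → (2 ≤ i) × (i ≤ suc (suc k)) × IsoToPath G i
  forward ((h , h-resolving , Σh≡1) , _) = n G , 2≤n , n≤2+k , isoToPath
    where
    0<1 : 0ℚ ℚ.< 1ℚ
    0<1 = toWitness {a? = 0ℚ ℚP.<? 1ℚ} tt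
    s-positive : ∃ λ s → 0ℚ ℚ.< h s
    s-positive = sumFin-positive⇒∃-positive h (subst (0ℚ ℚ.<_) (sym Σh≡1) 0<1)
    s : Fin (n G)
    s = proj₁ s-positive
    open ResolvingLayering G k (proj₂ (connected⇒layering G conn s))
      (unitResolving⇒resolvingVertex G k h s h-resolving Σh≡1 (proj₂ s-positive))
  backward : (∃ λ i → (2 ≤ i) × (i ≤ suc (suc k)) × IsoToPath G i) → DimKF≡ G k 1ℚ
  backward (i , 2≤i , i≤2+k , σ , σ-adj) =
    ( indicator endpoint
    , indicator-resolving G k endpoint (endpoint-resolving k i≤2+k)
    , sumFin-indicator endpoint )
    , λ h → resolving⇒1≤sumFin G k h 2≤n
    where
    open PathEndpoint G σ σ-adj (ℕP.≤-trans (s≤s z≤n) 2≤i)
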